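{- There is no algorithm in the read/write streams model that uses only one stream, $\log^{O(1)} n$ bits of internal memory and $\log^{O(1)} n$ passes and that, given a string $s$ of length $n$ and a number $\ell$, correctly checks whether $\ell$ is the minimum period of $s$.
   Context: Read/write streams model: an algorithm has an internal memory of $m$ bits and access to a fixed number of streams (tapes); each stream is a sequence of cells accessed sequentially by a read/write head; a pass is one sequential sweep over a stream. The input is initially on the stream. The minimum period of $s$ is the least $\ell\ge1$ with $s[i]=s[i+\ell]$ for all $1\le i\le n-\ell$. -}

module Defs where

open import Data.Nat using (ℕ; zero; suc; _+_; _∸_; _^_; _≤_; _≟_; _<?_)
open import Data.Fin using (Fin; toℕ; fromℕ<)
open import Data.Bool using (Bool; true; false)
open import Data.Maybe using (Maybe; just; nothing)
open import Data.Product using (_×_; _,_; Σ)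
open import Relation.Binary.PropositionalEquality using (_≡_)
open import Relation.Nullary using (yes; no)

IsPeriod : ∀ {σ n} → ℕ → (Fin n → Fin σ) → Set
IsPeriod {n = n} ℓ s =
  1 ≤ ℓ × (∀ (i j : Fin n) → toℕ j ≡ toℕ i + ℓ → s i ≡ s j)

IsMinPeriod : ∀ {σ n} → ℕ → (Fin n → Fin σ) → Set
IsMinPeriod ℓ s = IsPeriod ℓ s × (∀ k → IsPeriod k s → ℓ ≤ k)

-- One-stream read/write streams machine (deterministic, non-uniform).
-- Internal memory of m bits = 2^m internal states (Fin (2 ^ m)).
-- The single stream is a one-way infinite tape of cells over a finite
-- tape alphabet Fin g (chosen by the algorithm), accessed by one head.
-- A pass is a maximal sequential sweep in one direction, so
-- #passes = 1 + #reversals of the head direction.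

data Dir : Set where
  left right : Dir

data Action (m g : ℕ) : Set where
  halt : Bool → Action m g
  step : Fin (2 ^ m) → Fin g → Dir → Action m g

record Machine (σ : ℕ) : Set where
  field
    mem    : ℕ
    gsize  : ℕ
    blank  : Fin gsize
    encode : Fin σ → Fin gsize
    init   : ℕ → Fin (2 ^ mem)      -- initial memory content, given the number ℓ
    δ      : Fin (2 ^ mem) → Fin gsize → Action mem gsize

record Config (m g : ℕ) : Set where
  constructor cfg
  field
    state : Fin (2 ^ m)
    tape  : ℕ → Fin g
    pos   : ℕ
    dir   : Dir
    revs  : ℕ

private
  write : ∀ {g} → (ℕ → Fin g) → ℕ → Fin g → ℕ → Fin g
  write t p a i with i ≟ p
  ... | yes _ = a
  ... | no  _ = t i

  move : Dir → ℕ → ℕ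
  move left  zero    = zero
  move left  (suc p) = p
  move right p       = suc p

  sameDir : Dir → Dir → Bool
  sameDir left  left  = true
  sameDir right right = true
  sameDir _     _     = false

  bump : Bool → ℕ → ℕ
  bump true  r = r
  bump false r = suc r

-- run for at most the given number of steps; result = (answer , #reversals)
run : ∀ {σ} (M : Machine σ) → Config (Machine.mem M) (Machine.gsize M) → ℕ → Maybe (Bool × ℕ)
run M c zero = nothing
run M (cfg q t p d r) (suc fuel) with Machine.δ M q (t p)
... | halt b       = just (b , r)
... | step q' a d' = run M (cfg q' (write t p a) (move d' p) d' (bump (sameDir d d') r)) fuel

initTape : ∀ {σ n} (M : Machine σ) → (Fin n → Fin σ) → ℕ → Fin (Machine.gsize M)
initTape {n = n} M s i with i <? n
... | yes i<n = Machine.encode M (s (fromℕ< i<n))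
... | no  _   = Machine.blank M

Runs : ∀ {σ n} (M : Machine σ) → (Fin n → Fin σ) → ℕ → Bool → ℕ → Set
Runs M s ℓ b p = Σ ℕ λ fuel →
  run M (cfg (Machine.init M ℓ) (initTape M s) 0 right 0) fuel ≡ just (b , p ∸ 1) × 1 ≤ p

-- Cut the stream between two cells.  A run that makes p passes
-- crosses the cut at most p times, and what happens on either side of the cut
-- depends only on that side's input and on the states in which the head
-- crosses.  Take the 2 ^ (a − 1) words u_x u_x with u_x = 1 0^a x, each of
-- minimum period |u_x|, and cut in the middle.  With polylogarithmic memory and
-- passes there are fewer crossing sequences than words, so some u_x u_x and
-- u_y u_y with x ≠ y share one; gluing their runs shows that u_x u_y is accepted
-- as well, although |u_x| is not a period of it.

module Submission where

open import Defs
open import Data.Nat using (ℕ; zero; suc; _+_; _*_; _∸_; _^_; _≤_; _<_; _≟_; _≤?_; _<?_; _<ᵇ_; s≤s; z≤n; pred)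
open import Data.Nat.Properties
open import Data.Nat.Logarithm using (⌊log₂_⌋; ⌊log₂[2^n]⌋≡n)
open import Data.Nat.Tactic.RingSolver using (solve-∀)
open import Data.Fin using (Fin; zero; suc; toℕ; fromℕ<; combine; quotient; remainder)
open import Data.Fin.Properties using (toℕ<n; toℕ-fromℕ<; combine-remQuot; combine-injective; pigeonhole)
open import Data.Bool using (Bool; true; false; not; _xor_; if_then_else_; T)
open import Data.Bool.Properties using (T-≡; not-involutive; not-¬)
open import Data.Maybe using (Maybe; just)
open import Data.Maybe.Properties using (just-injective)
open import Data.Product using (Σ; _×_; _,_; proj₁; proj₂)
open import Data.List using (List; []; _∷_; length)
open import Data.Empty using (⊥)
open import Function using (Equivalence; _∘_)
open import Relation.Binary.PropositionalEquality
open import Relation.Nullary using (¬_; yes; no; contradiction)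

<⇒<ᵇ≡true : ∀ {m n} → m < n → (m <ᵇ n) ≡ true
<⇒<ᵇ≡true m<n = Equivalence.to T-≡ (<⇒<ᵇ m<n)

<ᵇ≡true⇒< : ∀ {m n} → (m <ᵇ n) ≡ true → m < n
<ᵇ≡true⇒< {m} {n} e = <ᵇ⇒< m n (Equivalence.from T-≡ e)

<ᵇ≡false⇒≥ : ∀ {m n} → (m <ᵇ n) ≡ false → n ≤ m
<ᵇ≡false⇒≥ e = ≮⇒≥ λ m<n → subst T e (<⇒<ᵇ m<n)

≥⇒<ᵇ≡false : ∀ {m n} → n ≤ m → (m <ᵇ n) ≡ false
≥⇒<ᵇ≡false {m} {n} n≤m with m <ᵇ n in e
... | true  = contradiction (<ᵇ≡true⇒< e) (≤⇒≯ n≤m)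
... | false = refl

writer : ∀ {g} → Fin g → Machine 1
writer {g} x = record { mem = 0 ; gsize = g ; blank = x ; encode = λ _ → x
                      ; init = λ _ → zero ; δ = λ _ _ → step zero x right }

-- Defs keeps its tape update private.  It is recovered here as the function
-- that unification finds for one step of a machine that always writes:
-- `tapeWrite t p a i` is definitionally the private `write t p a i`.
tapeWrite : ∀ {g} → (ℕ → Fin g) → ℕ → Fin g → ℕ → Fin g
tapeWrite = proj₁ recovered
  where
  recovered : Σ (∀ {g} → (ℕ → Fin g) → ℕ → Fin g → ℕ → Fin g) λ w →
    ∀ {g} t p (x : Fin g) f →
      run (writer x) (cfg zero t p right 0) (suc f)
        ≡ run (writer x) (cfg zero (w t p x) (suc p) right 0) f
  recovered = _ , λ t p x f → refl

tapeWrite-other : ∀ {g} (t : ℕ → Fin g) p a i → i ≢ p → tapeWrite t p a i ≡ t i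
tapeWrite-other t p a i i≢p with i ≟ p
... | yes i≡p = contradiction i≡p i≢p
... | no  _   = refl

tapeWrite-cong : ∀ {g} (t t′ : ℕ → Fin g) p a i →
                 (i ≢ p → t i ≡ t′ i) → tapeWrite t p a i ≡ tapeWrite t′ p a i
tapeWrite-cong t t′ p a i eq with i ≟ p
... | yes _   = refl
... | no  i≢p = eq i≢p

moveHead : Dir → ℕ → ℕ
moveHead left  zero    = zero
moveHead left  (suc p) = p
moveHead right p       = suc p

reversalsAfter : Dir → Dir → ℕ → ℕ
reversalsAfter left  left  r = r
reversalsAfter right right r = r
reversalsAfter left  right r = suc r
reversalsAfter right left  r = suc r

module Semantics {σ} (M : Machine σ) where
  open Machine M public
  open Config public

  Conf : Set
  Conf = Config mem gsize

  data Outcome : Set where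
    halted : Bool → ℕ → Outcome
    moved  : Conf → Outcome

  perform : Action mem gsize → Conf → Outcome
  perform (halt b)       c               = halted b (revs c)
  perform (step q′ a d′) (cfg q t p d r) =
    moved (cfg q′ (tapeWrite t p a) (moveHead d′ p) d′ (reversalsAfter d d′ r))

  next : Conf → Outcome
  next c = perform (δ (state c) (tape c (pos c))) c

  start : ∀ {n} → (Fin n → Fin σ) → ℕ → Conf
  start s ℓ = cfg (init ℓ) (initTape M s) 0 right 0

  continue : Outcome → ℕ → Maybe (Bool × ℕ)
  continue (halted b r) f = just (b , r)
  continue (moved c)    f = run M c f

  run-suc : ∀ c f → run M c (suc f) ≡ continue (next c) f
  run-suc (cfg q t p d r) f with δ q (t p)
  ... | halt b = refl
  run-suc (cfg q t p       left  r) f | step q′ a right = refl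
  run-suc (cfg q t p       right r) f | step q′ a right = refl
  run-suc (cfg q t zero    left  r) f | step q′ a left  = refl
  run-suc (cfg q t (suc p) left  r) f | step q′ a left  = refl
  run-suc (cfg q t zero    right r) f | step q′ a left  = refl
  run-suc (cfg q t (suc p) right r) f | step q′ a left  = refl

  run-functional : ∀ c f f′ {x y} → run M c f ≡ just x → run M c f′ ≡ just y → x ≡ y
  run-functional c zero    f′       ()
  run-functional c (suc f) zero     _  ()
  run-functional c (suc f) (suc f′) hx hy =
    continue-functional (next c) (trans (sym (run-suc c f)) hx) (trans (sym (run-suc c f′)) hy)
    where
    continue-functional : ∀ o {x y} → continue o f ≡ just x → continue o f′ ≡ just y → x ≡ y
    continue-functional (halted b r) hx hy = trans (sym (just-injective hx)) (just-injective hy)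
    continue-functional (moved c′)   hx hy = run-functional c′ f f′ hx hy

module Cut {σ} (M : Machine σ) (k′ : ℕ) where
  open Semantics M

  k : ℕ
  k = suc k′

  isLeft : ℕ → Bool
  isLeft i = i <ᵇ k

  isLeft⇒< : ∀ {i} → isLeft i ≡ true → i < k
  isLeft⇒< {i} = <ᵇ≡true⇒< {i} {k}

  <⇒isLeft : ∀ {i} → i < k → isLeft i ≡ true
  <⇒isLeft = <⇒<ᵇ≡true

  isRight⇒≥ : ∀ {i} → isLeft i ≡ false → k ≤ i
  isRight⇒≥ {i} = <ᵇ≡false⇒≥ {i} {k}

  ≥⇒isRight : ∀ {i} → k ≤ i → isLeft i ≡ false
  ≥⇒isRight = ≥⇒<ᵇ≡false

  sides-differ : ∀ {s i p} → isLeft i ≡ not s → isLeft p ≡ s → i ≢ p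
  sides-differ ei ep refl = not-¬ ep ei

  -- the cell next to the cut on the side opposite to s
  landing : Bool → ℕ
  landing true  = k
  landing false = k′

  isLeft-landing : ∀ s → isLeft (landing s) ≡ not s
  isLeft-landing true  = ≥⇒isRight ≤-refl
  isLeft-landing false = <⇒isLeft ≤-refl

  crossing-lands : ∀ {s} d p → isLeft p ≡ s → isLeft (moveHead d p) ≡ not s →
                   moveHead d p ≡ landing s
  crossing-lands {true}  left  zero    _  ()
  crossing-lands {true}  left  (suc p) e  e′ =
    contradiction (isLeft⇒< e) (≤⇒≯ (≤-trans (isRight⇒≥ e′) (n≤1+n p)))
  crossing-lands {true}  right p       e  e′ = ≤-antisym (isLeft⇒< e) (isRight⇒≥ e′)
  crossing-lands {false} left  zero    () _
  crossing-lands {false} left  (suc p) e  e′ = ≤-antisym (≤-pred (isLeft⇒< e′)) (≤-pred (isRight⇒≥ e))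
  crossing-lands {false} right p       e  e′ =
    contradiction (isLeft⇒< e′) (≤⇒≯ (≤-trans (isRight⇒≥ e) (n≤1+n p)))

  moving-left-stays-left : ∀ p → isLeft p ≡ true → isLeft (moveHead left p) ≡ true
  moving-left-stays-left zero    e = e
  moving-left-stays-left (suc p) e = <⇒isLeft (<-trans (n<1+n p) (isLeft⇒< e))

  moving-right-stays-right : ∀ p → isLeft p ≡ false → isLeft (moveHead right p) ≡ false
  moving-right-stays-right p e = ≥⇒isRight (≤-trans (isRight⇒≥ e) (n≤1+n p))

  crossed : Conf → Conf → Bool
  crossed c c′ = isLeft (pos c) xor isLeft (pos c′)

  -- the states entered just after each crossing between cells k′ and k
  mutual
    crossings : Conf → ℕ → List (Fin (2 ^ mem))
    crossings c zero    = []
    crossings c (suc f) = crossingsFrom c (next c) f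

    crossingsFrom : Conf → Outcome → ℕ → List (Fin (2 ^ mem))
    crossingsFrom c (halted _ _) f = []
    crossingsFrom c (moved c′)   f =
      if crossed c c′ then state c′ ∷ crossings c′ f else crossings c′ f

  xor≡true : ∀ a b → a xor b ≡ true → b ≡ not a
  xor≡true true  false _ = refl
  xor≡true false true  _ = refl

  xor≡false : ∀ a b → a xor b ≡ false → b ≡ a
  xor≡false true  true  _ = refl
  xor≡false false false _ = refl

  crossed⇒flips : ∀ {s} c c′ → isLeft (pos c) ≡ s → crossed c c′ ≡ true → isLeft (pos c′) ≡ not s
  crossed⇒flips c c′ refl x = xor≡true (isLeft (pos c)) (isLeft (pos c′)) x

  ¬crossed⇒stays : ∀ {s} c c′ → isLeft (pos c) ≡ s → crossed c c′ ≡ false → isLeft (pos c′) ≡ s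
  ¬crossed⇒stays c c′ refl x = xor≡false (isLeft (pos c)) (isLeft (pos c′)) x

  perform-keeps-far : ∀ {s} X c {c′} → isLeft (pos c) ≡ s → perform X c ≡ moved c′ →
                      ∀ i → isLeft i ≡ not s → tape c′ i ≡ tape c i
  perform-keeps-far (step q a d) c cs refl i ei = tapeWrite-other (tape c) (pos c) a i (sides-differ ei cs)

  perform-lands : ∀ {s} X c {c′} → isLeft (pos c) ≡ s → perform X c ≡ moved c′ →
                  isLeft (pos c′) ≡ not s → pos c′ ≡ landing s
  perform-lands (step q a d) c cs refl = crossing-lands d (pos c) cs

  record NextCrossing (s : Bool) (Z : Conf) (f : ℕ) (x : Bool × ℕ)
                      (q : Fin (2 ^ mem)) (R : List (Fin (2 ^ mem))) : Set where
    field
      conf   : Conf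
      fuel   : ℕ
      fuel<  : fuel < f
      runs   : run M conf fuel ≡ just x
      later  : crossings conf fuel ≡ R
      state≡ : state conf ≡ q
      pos≡   : pos conf ≡ landing s
      keeps  : ∀ i → isLeft i ≡ not s → tape conf i ≡ tape Z i

  advance : ∀ {s} Z f {x q R} → isLeft (pos Z) ≡ s → run M Z f ≡ just x →
            crossings Z f ≡ q ∷ R → NextCrossing s Z f x q R
  advance {s} Z (suc f) {x} {q} {R} Zs h cr = go (next Z) refl (trans (sym (run-suc Z f)) h) cr
    where
    go : ∀ o → next Z ≡ o → continue o f ≡ just x → crossingsFrom Z o f ≡ q ∷ R →
         NextCrossing s Z (suc f) x q R
    go (moved Z′) eq h cr with crossed Z Z′ in cx
    ... | true with refl ← cr = record
      { conf = Z′ ; fuel = f ; fuel< = ≤-refl ; runs = h ; later = refl ; state≡ = refl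
      ; pos≡ = perform-lands _ Z Zs eq (crossed⇒flips Z Z′ Zs cx)
      ; keeps = perform-keeps-far _ Z Zs eq }
    ... | false = record
      { conf = conf ; fuel = fuel ; fuel< = m<n⇒m<1+n fuel< ; runs = runs ; later = later
      ; state≡ = state≡ ; pos≡ = pos≡
      ; keeps = λ i ei → trans (keeps i ei) (perform-keeps-far _ Z Zs eq i ei) }
      where open NextCrossing (advance Z′ f (¬crossed⇒stays Z Z′ Zs cx) h cr)

  -- c runs on side s like L, while its other side still holds Z's tape
  record Glued (s : Bool) (c L Z : Conf) : Set where
    field
      state≡ : state c ≡ state L
      pos≡   : pos c ≡ pos L
      near   : ∀ i → isLeft i ≡ s → tape c i ≡ tape L i
      far    : ∀ i → isLeft i ≡ not s → tape c i ≡ tape Z i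

  data Follows (s : Bool) (Z : Conf) : Outcome → Outcome → Set where
    both-halt : ∀ {b r r′} → Follows s Z (halted b r′) (halted b r)
    both-move : ∀ {c′ L′} → Glued s c′ L′ Z → Follows s Z (moved c′) (moved L′)

  perform-glued : ∀ {s c L Z} X → Glued s c L Z → isLeft (pos L) ≡ s →
                  Follows s Z (perform X c) (perform X L)
  perform-glued (halt b) g Ls = both-halt
  perform-glued {c = c} {L} (step q a d) g Ls = both-move record
    { state≡ = refl
    ; pos≡   = cong (moveHead d) pos≡
    ; near   = λ i ei → trans (cong (λ p → tapeWrite (tape c) p a i) pos≡)
                              (tapeWrite-cong (tape c) (tape L) (pos L) a i λ _ → near i ei)
    ; far    = λ i ei → trans (tapeWrite-other (tape c) (pos c) a i
                                 (sides-differ ei (trans (cong isLeft pos≡) Ls)))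
                              (far i ei)
    }
    where open Glued g

  glued-next : ∀ {s c L Z} → Glued s c L Z → isLeft (pos L) ≡ s → Follows s Z (next c) (next L)
  glued-next {s} {c} {L} {Z} g Ls =
    subst (λ X → Follows s Z (perform X c) (next L)) (sym reads-alike) (perform-glued _ g Ls)
    where
    open Glued g
    reads-alike : δ (state c) (tape c (pos c)) ≡ δ (state L) (tape L (pos L))
    reads-alike = cong₂ δ state≡ (trans (cong (tape c) pos≡) (near (pos L) Ls))

  reglue : ∀ {s c L Z Z′} → Glued s c L Z → state Z′ ≡ state L → pos Z′ ≡ pos L →
           (∀ i → isLeft i ≡ not s → tape Z′ i ≡ tape Z i) → Glued (not s) c Z′ L
  reglue {s} g sZ pZ keeps = record
    { state≡ = trans state≡ (sym sZ)
    ; pos≡   = trans pos≡ (sym pZ)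
    ; near   = λ i ei → trans (far i ei) (sym (keeps i ei))
    ; far    = λ i ei → near i (trans ei (not-involutive s))
    }
    where open Glued g

  -- Whenever L crosses the cut, Z is advanced to its matching crossing and
  -- the two runs swap roles; the equal crossing sequences keep c glued.
  cut-and-paste : ∀ bound {s} L Z c fL fZ {rL rZ} → fL + fZ < bound →
    isLeft (pos L) ≡ s → isLeft (pos Z) ≡ s → Glued s c L Z →
    run M L fL ≡ just (true , rL) → run M Z fZ ≡ just (true , rZ) →
    crossings L fL ≡ crossings Z fZ → Σ ℕ λ f → Σ ℕ λ r → run M c f ≡ just (true , r)
  cut-and-paste (suc bound) {s} L Z c (suc fL) fZ {rL} {rZ} (s≤s bounded) Ls Zs g hL hZ same
    with resume (glued-next g Ls) refl (trans (sym (run-suc L fL)) hL) same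
    where
    resume : ∀ {oc oL} → Follows s Z oc oL → next L ≡ oL → continue oL fL ≡ just (true , rL) →
             crossingsFrom L oL fL ≡ crossings Z fZ →
             Σ ℕ λ f → Σ ℕ λ r → continue oc f ≡ just (true , r)
    resume both-halt _ h _ with refl ← just-injective h = 0 , _ , refl
    resume (both-move {c′} {L′} g′) eqL h cr with crossed L L′ in cx
    ... | false = cut-and-paste bound L′ Z c′ fL fZ bounded (¬crossed⇒stays L L′ Ls cx) Zs g′ h hZ cr
    ... | true  =
      cut-and-paste bound conf L′ c′ fuel fL
        (<-≤-trans (+-monoˡ-< fL fuel<) (≤-trans (≤-reflexive (+-comm fZ fL)) (<⇒≤ bounded)))
        (trans (cong isLeft pos≡) (isLeft-landing s)) L′-flips
        (reglue g′ state≡ (trans pos≡ (sym (perform-lands _ L Ls eqL L′-flips))) keeps)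
        runs h later
      where
      L′-flips = crossed⇒flips L L′ Ls cx
      open NextCrossing (advance Z fZ Zs hZ (sym cr))
  ... | f , r , e = suc f , r , trans (run-suc c f) e

  -- 1 when the head moves away from the cut: the current pass cannot cross it again
  awayFromCut : Bool → Dir → ℕ
  awayFromCut true  left  = 1
  awayFromCut true  right = 0
  awayFromCut false left  = 0
  awayFromCut false right = 1

  awayFromCut≤1 : ∀ s d → awayFromCut s d ≤ 1
  awayFromCut≤1 true  left  = ≤-refl
  awayFromCut≤1 true  right = z≤n
  awayFromCut≤1 false left  = z≤n
  awayFromCut≤1 false right = ≤-refl

  potential : Conf → ℕ
  potential c = awayFromCut (isLeft (pos c)) (dir c) + revs c

  potential-step : ∀ s s′ d d′ r →
    (s ≡ true → d′ ≡ left → s′ ≡ true) → (s ≡ false → d′ ≡ right → s′ ≡ false) →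
    (if s xor s′ then 1 else 0) + (awayFromCut s d + r) ≤ awayFromCut s′ d′ + reversalsAfter d d′ r
  potential-step true  true  left  left  r _ _ = ≤-refl
  potential-step true  true  left  right r _ _ = ≤-refl
  potential-step true  true  right left  r _ _ = m≤n+m r 2
  potential-step true  true  right right r _ _ = ≤-refl
  potential-step true  false d     left  r h _ = contradiction (h refl refl) λ ()
  potential-step true  false left  right r _ _ = ≤-refl
  potential-step true  false right right r _ _ = ≤-refl
  potential-step false true  d     right r _ h = contradiction (h refl refl) λ ()
  potential-step false true  left  left  r _ _ = ≤-refl
  potential-step false true  right left  r _ _ = ≤-refl
  potential-step false false left  left  r _ _ = ≤-refl
  potential-step false false left  right r _ _ = m≤n+m r 2
  potential-step false false right left  r _ _ = ≤-refl
  potential-step false false right right r _ _ = ≤-refl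

  perform-potential : ∀ X c {c′} → perform X c ≡ moved c′ →
                      (if crossed c c′ then 1 else 0) + potential c ≤ potential c′
  perform-potential (step q a d′) c refl =
    potential-step (isLeft (pos c)) _ (dir c) d′ (revs c)
      (λ e → λ { refl → moving-left-stays-left (pos c) e })
      (λ e → λ { refl → moving-right-stays-right (pos c) e })

  perform-halts : ∀ X c {b r} → perform X c ≡ halted b r → r ≡ revs c
  perform-halts (halt b) c refl = refl

  -- The potential never drops, and rises at each crossing.
  crossings-bound : ∀ c f {b R} → run M c f ≡ just (b , R) → length (crossings c f) + potential c ≤ suc R
  crossings-bound c (suc f) {b} {R} h = go (next c) refl (trans (sym (run-suc c f)) h)
    where
    go : ∀ o → next c ≡ o → continue o f ≡ just (b , R) →
         length (crossingsFrom c o f) + potential c ≤ suc R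
    go (halted _ r) eq h with refl ← just-injective h =
      subst (λ r → potential c ≤ suc r) (sym (perform-halts _ c eq))
            (+-monoˡ-≤ (revs c) (awayFromCut≤1 (isLeft (pos c)) (dir c)))
    go (moved c′) eq h = count-crossing (crossed c c′) (perform-potential _ c eq) (crossings-bound c′ f h)
      where
      ncs = length (crossings c′ f)
      count-crossing : ∀ x → (if x then 1 else 0) + potential c ≤ potential c′ →
                       length (crossings c′ f) + potential c′ ≤ suc R →
                       length (if x then state c′ ∷ crossings c′ f else crossings c′ f) + potential c ≤ suc R
      count-crossing true  rises ih =
        ≤-trans (≤-reflexive (sym (+-suc ncs (potential c)))) (≤-trans (+-monoʳ-≤ ncs rises) ih)
      count-crossing false rises ih = ≤-trans (+-monoʳ-≤ ncs rises) ih

  crossings-≤-passes : ∀ {n} (s : Fin n → Fin σ) ℓ f {b p} →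
    run M (start s ℓ) f ≡ just (b , p ∸ 1) → 1 ≤ p → length (crossings (start s ℓ) f) ≤ p
  crossings-≤-passes s ℓ f h 1≤p =
    ≤-trans (≤-reflexive (sym (+-identityʳ _)))
      (≤-trans (crossings-bound (start s ℓ) f h) (≤-reflexive (trans (+-comm 1 _) (m∸n+n≡m 1≤p))))

period-at : ∀ {σ n ℓ} (f : ℕ → Fin σ) → IsPeriod ℓ (f ∘ toℕ {n}) → ∀ i → i + ℓ < n → f i ≡ f (i + ℓ)
period-at {ℓ = ℓ} f (_ , per) i i+ℓ<n =
  subst₂ (λ u v → f u ≡ f v) (toℕ-fromℕ< i<n) (toℕ-fromℕ< i+ℓ<n)
    (per (fromℕ< i<n) (fromℕ< i+ℓ<n)
         (trans (toℕ-fromℕ< i+ℓ<n) (cong (_+ ℓ) (sym (toℕ-fromℕ< i<n)))))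
  where
  i<n = ≤-<-trans (m≤m+n i ℓ) i+ℓ<n

period-from : ∀ {σ n ℓ} (f : ℕ → Fin σ) → 1 ≤ ℓ → (∀ i → i + ℓ < n → f i ≡ f (i + ℓ)) →
              IsPeriod ℓ (f ∘ toℕ {n})
period-from f 1≤ℓ per = 1≤ℓ , λ i j e →
  subst (λ v → f (toℕ i) ≡ f v) (sym e) (per (toℕ i) (subst (_< _) e (toℕ<n j)))

initTape-cong : ∀ {σ n} (M : Machine σ) (f g : ℕ → Fin σ) i → (i < n → f i ≡ g i) →
                initTape M (f ∘ toℕ {n}) i ≡ initTape M (g ∘ toℕ {n}) i
initTape-cong {n = n} M f g i eq with i <? n
... | yes i<n = cong (Machine.encode M) (subst (λ j → f j ≡ g j) (sym (toℕ-fromℕ< i<n)) (eq i<n))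
... | no  _   = refl

-- `word x y` is u_x u_y with the block u_x = 1 0^a x of length K, where |x| = a′ = a − 1.
module Fooling (a′ : ℕ) where
  a K n : ℕ
  a = suc a′
  K = a + a
  n = K + K

  module _ {σ′ : ℕ} where
    bitSymbol : Fin 2 → Fin (suc (suc σ′))
    bitSymbol zero       = zero
    bitSymbol (suc zero) = suc zero

    bitSymbol-injective : ∀ u v → bitSymbol u ≡ bitSymbol v → u ≡ v
    bitSymbol-injective zero       zero       _  = refl
    bitSymbol-injective (suc zero) (suc zero) _  = refl
    bitSymbol-injective zero       (suc zero) ()
    bitSymbol-injective (suc zero) zero       ()

    block : (ℕ → Fin 2) → ℕ → Fin (suc (suc σ′))
    block x zero    = suc zero
    block x (suc u) = if u <ᵇ a then zero else bitSymbol (x (u ∸ a))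

    glue : (ℕ → Fin 2) → (ℕ → Fin 2) → ℕ → Fin (suc (suc σ′))
    glue x y i = if i <ᵇ K then block x i else block y (i ∸ K)

    word : (ℕ → Fin 2) → (ℕ → Fin 2) → Fin n → Fin (suc (suc σ′))
    word x y = glue x y ∘ toℕ

    block-gap : ∀ x {u} → u < a → block x (suc u) ≡ zero
    block-gap x u<a rewrite <⇒<ᵇ≡true u<a = refl

    block-bit : ∀ x u → block x (suc (a + u)) ≡ bitSymbol (x u)
    block-bit x u rewrite ≥⇒<ᵇ≡false (m≤m+n a u) = cong (bitSymbol ∘ x) (m+n∸m≡n a u)

    glue-left : ∀ x y i → i < K → glue x y i ≡ block x i
    glue-left x y i i<K rewrite <⇒<ᵇ≡true i<K = refl

    glue-right : ∀ x y i → K ≤ i → glue x y i ≡ block y (i ∸ K)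
    glue-right x y i K≤i rewrite ≥⇒<ᵇ≡false K≤i = refl

    glue-shift : ∀ x y i → glue x y (i + K) ≡ block y i
    glue-shift x y i = trans (glue-right x y (i + K) (m≤n+m K i)) (cong (block y) (m+n∸n≡m i K))

    word-period : ∀ x → IsPeriod K (word x x)
    word-period x = period-from (glue x x) (s≤s z≤n) λ i i+K<n →
      trans (glue-left x x i (+-cancelʳ-< K i K i+K<n)) (sym (glue-shift x x i))

    one≢zero : _≢_ {A = Fin (suc (suc σ′))} (suc zero) zero
    one≢zero ()

    no-period-≤a : ∀ x v → suc v ≤ a → ¬ IsPeriod (suc v) (word x x)
    no-period-≤a x v v<a per = one≢zero
      (trans (period-at (glue x x) per 0 (<-≤-trans v<K (m≤m+n K K)))
             (trans (glue-left x x (suc v) v<K) (block-gap x v<a)))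
      where
      v<K : suc v < K
      v<K = ≤-trans (s≤s v<a) (m<m+n a (s≤s z≤n))

    -- position K − ℓ lies in the gap 0^a, position K holds the leading 1
    no-period->a : ∀ x ℓ v → a < ℓ → suc ℓ + v ≡ K → ¬ IsPeriod ℓ (word x x)
    no-period->a x ℓ v a<ℓ 1+ℓ+v≡K per = one≢zero (begin
      suc zero              ≡⟨ glue-shift x x 0 ⟨
      glue x x K            ≡⟨ cong (glue x x) lands-at-K ⟨
      glue x x (suc v + ℓ)  ≡⟨ period-at (glue x x) per (suc v) (subst (_< n) (sym lands-at-K) K<n) ⟨
      glue x x (suc v)      ≡⟨ glue-left x x (suc v) (≤-trans (s≤s v<a) (m<m+n a (s≤s z≤n))) ⟩
      block x (suc v)       ≡⟨ block-gap x v<a ⟩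
      zero                  ∎)
      where
      open ≡-Reasoning
      K<n = m<m+n K (s≤s z≤n)
      lands-at-K : suc v + ℓ ≡ K
      lands-at-K = trans (cong suc (+-comm v ℓ)) 1+ℓ+v≡K
      v<a : v < a
      v<a = +-cancelˡ-< a v a (<-trans (+-monoˡ-< v a<ℓ) (subst (ℓ + v <_) 1+ℓ+v≡K (n<1+n (ℓ + v))))

    word-minimal : ∀ x ℓ → IsPeriod ℓ (word x x) → K ≤ ℓ
    word-minimal x ℓ per with K ≤? ℓ | ℓ ≤? a | proj₁ per
    ... | yes K≤ℓ | _       | _     = K≤ℓ
    ... | no  K≰ℓ | yes ℓ≤a | s≤s _ = contradiction per (no-period-≤a x _ ℓ≤a)
    ... | no  K≰ℓ | no  ℓ≰a | _     =
      contradiction per (no-period->a x ℓ _ (≰⇒> ℓ≰a) (proj₂ (m≤n⇒∃[o]m+o≡n (≰⇒> K≰ℓ))))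

    word-period⇒agree : ∀ x y → IsPeriod K (word x y) → ∀ u → u < a′ → x u ≡ y u
    word-period⇒agree x y per u u<a′ = bitSymbol-injective (x u) (y u) (begin
      bitSymbol (x u)   ≡⟨ block-bit x u ⟨
      block x i         ≡⟨ glue-left x y i i<K ⟨
      glue x y i        ≡⟨ period-at (glue x y) per i (+-monoˡ-< K i<K) ⟩
      glue x y (i + K)  ≡⟨ glue-shift x y i ⟩
      block y i         ≡⟨ block-bit y u ⟩
      bitSymbol (y u)   ∎)
      where
      open ≡-Reasoning
      i = suc (a + u)
      i<K : i < K
      i<K = subst (_≤ K) (trans (+-suc a (suc u)) (cong suc (+-suc a u))) (+-monoʳ-≤ a (s≤s u<a′))

bits : ∀ L → Fin (2 ^ L) → ℕ → Fin 2
bits zero    _ _       = zero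
bits (suc L) x zero    = quotient (2 ^ L) x
bits (suc L) x (suc u) = bits L (remainder {2} (2 ^ L) x) u

bits-injective : ∀ L x y → (∀ u → u < L → bits L x u ≡ bits L y u) → x ≡ y
bits-injective zero    zero zero _ = refl
bits-injective (suc L) x    y    eq = begin
  x                                                 ≡⟨ combine-remQuot {2} (2 ^ L) x ⟨
  combine (quotient (2 ^ L) x) (remainder {2} (2 ^ L) x)
    ≡⟨ cong₂ combine (eq zero (s≤s z≤n)) (bits-injective L _ _ λ u u<L → eq (suc u) (s≤s u<L)) ⟩
  combine (quotient (2 ^ L) y) (remainder {2} (2 ^ L) y) ≡⟨ combine-remQuot {2} (2 ^ L) y ⟩
  y                                                 ∎
  where open ≡-Reasoning

-- a list of length at most P over Fin Q, padded with a fresh symbol to exactly P letters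
encodeList : ∀ {Q} P → List (Fin Q) → Fin (suc Q ^ P)
encodeList     zero    _        = zero
encodeList {Q} (suc P) []       = combine {suc Q} zero    (encodeList P [])
encodeList {Q} (suc P) (q ∷ qs) = combine {suc Q} (suc q) (encodeList P qs)

encodeList-injective : ∀ {Q} P (qs rs : List (Fin Q)) → length qs ≤ P → length rs ≤ P →
                       encodeList P qs ≡ encodeList P rs → qs ≡ rs
encodeList-injective zero    []       []       _         _         _ = refl
encodeList-injective (suc P) []       []       _         _         _ = refl
encodeList-injective {Q} (suc P) []       (r ∷ rs) _         _         e
  with () ← proj₁ (combine-injective {m = suc Q} {n = suc Q ^ P} zero _ (suc r) _ e)
encodeList-injective {Q} (suc P) (q ∷ qs) []       _         _         e
  with () ← proj₁ (combine-injective {m = suc Q} {n = suc Q ^ P} (suc q) _ zero _ e)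
encodeList-injective {Q} (suc P) (q ∷ qs) (r ∷ rs) (s≤s |qs|) (s≤s |rs|) e
  with refl , e′ ← combine-injective {m = suc Q} {n = suc Q ^ P} (suc q) _ (suc r) _ e
  = cong (q ∷_) (encodeList-injective P qs rs |qs| |rs| e′)

1+2^n≤2^[1+n] : ∀ n → suc (2 ^ n) ≤ 2 ^ suc n
1+2^n≤2^[1+n] n = begin
  suc (2 ^ n)     ≡⟨ +-comm 1 (2 ^ n) ⟩
  2 ^ n + 1       ≤⟨ +-monoʳ-≤ (2 ^ n) (m^n>0 2 n) ⟩
  2 ^ n + 2 ^ n   ≡⟨ cong (2 ^ n +_) (+-identityʳ (2 ^ n)) ⟨
  2 ^ suc n       ∎
  where open ≤-Reasoning

n<2^n : ∀ n → n < 2 ^ n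
n<2^n zero    = s≤s z≤n
n<2^n (suc n) = ≤-trans (s≤s (n<2^n n)) (1+2^n≤2^[1+n] n)

square≤2^ : ∀ i → (4 + i) * (4 + i) ≤ 2 ^ (4 + i)
square≤2^ zero    = ≤-refl
square≤2^ (suc i) = begin
  (5 + i) * (5 + i)                          ≤⟨ m≤m+n _ (7 + 6 * i + i * i) ⟩
  (5 + i) * (5 + i) + (7 + 6 * i + i * i)    ≡⟨ expand i ⟩
  2 * ((4 + i) * (4 + i))                    ≤⟨ *-monoʳ-≤ 2 (square≤2^ i) ⟩
  2 ^ (5 + i)                                ∎
  where
  open ≤-Reasoning
  expand : ∀ i → (5 + i) * (5 + i) + (7 + 6 * i + i * i) ≡ 2 * ((4 + i) * (4 + i))
  expand = solve-∀

linear<2^ : ∀ D N → let j = 4 + (D + N) in 2 + suc j * D < 2 ^ j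
linear<2^ D N = begin-strict
  2 + suc j * D        <⟨ n<1+n _ ⟩
  3 + suc j * D        ≡⟨ split-linear D N ⟩
  j * D + (3 + D)      ≤⟨ +-monoʳ-≤ (j * D) 3+D≤ ⟩
  j * D + j * (4 + N)  ≡⟨ split-square D N ⟨
  j * j                ≤⟨ square≤2^ (D + N) ⟩
  2 ^ j                ∎
  where
  open ≤-Reasoning
  j = 4 + (D + N)
  split-linear : ∀ D N → 3 + suc (4 + (D + N)) * D ≡ (4 + (D + N)) * D + (3 + D)
  split-linear = solve-∀
  split-square : ∀ D N → (4 + (D + N)) * (4 + (D + N)) ≡ (4 + (D + N)) * D + (4 + (D + N)) * (4 + N)
  split-square = solve-∀
  3+D≤ : 3 + D ≤ j * (4 + N)
  3+D≤ = ≤-trans (≤-trans (n≤1+n (3 + D)) (m≤m+n (4 + D) N))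
                 (≤-trans (≤-reflexive (+-assoc 4 D N)) (m≤m*n j (4 + N)))

power-room : ∀ m P A → m ≤ P → suc P * P < A → suc (2 ^ m) ^ P < 2 ^ A
power-room m P A m≤P PP<A = begin-strict
  suc (2 ^ m) ^ P      ≤⟨ ^-monoˡ-≤ P (≤-trans (1+2^n≤2^[1+n] m) (^-monoʳ-≤ 2 (s≤s m≤P))) ⟩
  (2 ^ suc P) ^ P      ≡⟨ ^-*-assoc 2 (suc P) P ⟩
  2 ^ (suc P * P)      <⟨ ^-monoʳ-< 2 (s≤s (s≤s z≤n)) PP<A ⟩
  2 ^ A                ∎
  where open ≤-Reasoning

-- n = 2 ^ (2 + 2 ^ j) makes ⌊log₂ n⌋ = 2 + 2 ^ j exact, and then P ≤ 2 ^ ((1 + j) c) with j ≫ c.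
room : ∀ c N → Σ ℕ λ a′ → let n = Fooling.n a′; P = ⌊log₂ n ⌋ ^ c in
       N ≤ n × (∀ m → m ≤ P → suc (2 ^ m) ^ P < 2 ^ a′)
room c N = a′ , N≤n , λ m m≤P →
  subst (λ L → suc (2 ^ m) ^ (L ^ c) < 2 ^ a′) (sym log≡B)
        (power-room m P a′ (subst (λ L → m ≤ L ^ c) log≡B m≤P) P-room)
  where
  open ≤-Reasoning
  D = c + c
  j = 4 + (D + N)
  t = 2 ^ j
  B = 2 + t
  P = B ^ c
  a′ = pred (2 ^ t)

  quadruple : ∀ x → (x + x) + (x + x) ≡ 2 * (2 * x)
  quadruple = solve-∀

  n≡2^B : Fooling.n a′ ≡ 2 ^ B
  n≡2^B = trans (cong (λ a → (a + a) + (a + a)) (suc-pred (2 ^ t) {{m^n≢0 2 t}})) (quadruple (2 ^ t))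

  log≡B : ⌊log₂ Fooling.n a′ ⌋ ≡ B
  log≡B = trans (cong ⌊log₂_⌋ n≡2^B) (⌊log₂[2^n]⌋≡n B)

  N≤n : N ≤ Fooling.n a′
  N≤n = begin
    N                 ≤⟨ ≤-trans (m≤n+m N D) (m≤n+m (D + N) 4) ⟩
    j                 ≤⟨ <⇒≤ (n<2^n j) ⟩
    t                 ≤⟨ m≤n+m t 2 ⟩
    B                 ≤⟨ <⇒≤ (n<2^n B) ⟩
    2 ^ B             ≡⟨ n≡2^B ⟨
    Fooling.n a′      ∎

  PP = P * P

  B≤2^[1+j] : B ≤ 2 ^ suc j
  B≤2^[1+j] = begin
    2 + t      ≡⟨ +-comm 2 t ⟩
    t + 2      ≤⟨ +-monoʳ-≤ t (^-monoʳ-≤ 2 {1} {j} (s≤s z≤n)) ⟩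
    t + t      ≡⟨ cong (t +_) (+-identityʳ t) ⟨
    2 ^ suc j  ∎

  4PP<2^t : (PP + PP) + (PP + PP) < 2 ^ t
  4PP<2^t = begin-strict
    (PP + PP) + (PP + PP)        ≡⟨ quadruple PP ⟩
    2 * (2 * PP)                 ≡⟨ cong (λ x → 2 * (2 * x)) (^-distribˡ-+-* B c c) ⟨
    2 * (2 * B ^ D)              ≤⟨ *-monoʳ-≤ 2 (*-monoʳ-≤ 2 (^-monoˡ-≤ D B≤2^[1+j])) ⟩
    2 * (2 * (2 ^ suc j) ^ D)    ≡⟨ cong (λ x → 2 * (2 * x)) (^-*-assoc 2 (suc j) D) ⟩
    2 ^ (2 + suc j * D)          <⟨ ^-monoʳ-< 2 (s≤s (s≤s z≤n)) (linear<2^ D N) ⟩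
    2 ^ t                        ∎

  P-room : suc P * P < a′
  P-room = ∸-monoˡ-≤ 1 (begin-strict
    suc (suc P * P)            ≤⟨ s≤s (+-monoˡ-≤ PP (m≤m*n P P {{m^n≢0 B c}})) ⟩
    suc (PP + PP)              ≡⟨ +-comm 1 (PP + PP) ⟩
    (PP + PP) + 1              ≤⟨ +-monoʳ-≤ (PP + PP) (≤-trans 1≤PP (m≤m+n PP PP)) ⟩
    (PP + PP) + (PP + PP)      <⟨ 4PP<2^t ⟩
    2 ^ t                      ∎)
    where
    1≤PP : 1 ≤ PP
    1≤PP = *-mono-≤ (m^n>0 B c) (m^n>0 B c)

DecidesMinPeriodWithin : ∀ {σ} → Machine σ → (n ℓ passes : ℕ) → Set
DecidesMinPeriodWithin {σ} M n ℓ passes = (s : Fin n → Fin σ) → Σ Bool λ b → Σ ℕ λ p →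
  Runs M s ℓ b p × (b ≡ true → IsMinPeriod ℓ s) × (IsMinPeriod ℓ s → b ≡ true) × p ≤ passes

module FoolingArgument {σ′} (a′ P : ℕ) (M : Machine (suc (suc σ′)))
  (few-sequences : suc (2 ^ Machine.mem M) ^ P < 2 ^ a′)
  (decides : DecidesMinPeriodWithin M (Fooling.n a′) (Fooling.K a′) P) where
  open Fooling a′
  open Semantics M
  open Cut M (a′ + suc a′)

  doubled : Fin (2 ^ a′) → Fin n → Fin (suc (suc σ′))
  doubled x = word (bits a′ x) (bits a′ x)

  record Accepted (x : Fin (2 ^ a′)) : Set where
    field
      fuel    : ℕ
      final   : ℕ
      accepts : run M (start (doubled x) K) fuel ≡ just (true , final)
      few     : length (crossings (start (doubled x) K) fuel) ≤ P

  accepted : ∀ x → Accepted x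
  accepted x with decides (doubled x)
  ... | b , p , (f , runs , 1≤p) , _ , complete , p≤P
    with refl ← complete (word-period (bits a′ x) , word-minimal (bits a′ x)) = record
    { fuel = f ; final = p ∸ 1 ; accepts = runs
    ; few = ≤-trans (crossings-≤-passes (doubled x) K f runs 1≤p) p≤P }

  crossingSequence : Fin (2 ^ a′) → List (Fin (2 ^ mem))
  crossingSequence x = crossings (start (doubled x) K) (Accepted.fuel (accepted x))

  same-crossings⇒same : ∀ x y → crossingSequence x ≡ crossingSequence y → x ≡ y
  same-crossings⇒same x y same
    with cut-and-paste _ (start (doubled x) K) (start (doubled y) K) (start mixed K) fx fy
           (n<1+n (fx + fy)) refl refl glued
           (Accepted.accepts (accepted x)) (Accepted.accepts (accepted y)) same
    where
    bx = bits a′ x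
    by = bits a′ y
    mixed = word bx by
    fx = Accepted.fuel (accepted x)
    fy = Accepted.fuel (accepted y)
    glued : Glued true (start mixed K) (start (doubled x) K) (start (doubled y) K)
    glued = record
      { state≡ = refl
      ; pos≡   = refl
      ; near   = λ i e → initTape-cong {n = n} M (glue bx by) (glue bx bx) i λ _ →
          trans (glue-left bx by i (isLeft⇒< e)) (sym (glue-left bx bx i (isLeft⇒< e)))
      ; far    = λ i e → initTape-cong {n = n} M (glue bx by) (glue by by) i λ _ →
          trans (glue-right bx by i (isRight⇒≥ e)) (sym (glue-right by by i (isRight⇒≥ e)))
      }
  ... | f , r , mixed-accepts with decides (word (bits a′ x) (bits a′ y))
  ... | b , p , (f′ , runs , _) , sound , _ , _
    with refl ← cong proj₁ (run-functional _ f f′ mixed-accepts runs) =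
    bits-injective a′ x y (word-period⇒agree _ _ (proj₁ (sound refl)))

  impossible : ⊥
  impossible with x , y , x<y , same-code ← pigeonhole few-sequences (encodeList P ∘ crossingSequence) =
    <⇒≢ x<y (cong toℕ (same-crossings⇒same x y
      (encodeList-injective P _ _ (Accepted.few (accepted x)) (Accepted.few (accepted y)) same-code)))

theorem6 : (σ : ℕ) → 2 ≤ σ →
    ¬ (Σ ℕ λ c → Σ ℕ λ N → Σ ((n : ℕ) → Machine σ) λ A →
         ((n : ℕ) → N ≤ n → Machine.mem (A n) ≤ ⌊log₂ n ⌋ ^ c)
       × ((n : ℕ) (s : Fin n → Fin σ) (ℓ : ℕ) →
            Σ Bool λ b → Σ ℕ λ p →
              Runs (A n) s ℓ b p
              × (b ≡ true → IsMinPeriod ℓ s)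
              × (IsMinPeriod ℓ s → b ≡ true)
              × (N ≤ n → p ≤ ⌊log₂ n ⌋ ^ c)))
theorem6 (suc (suc σ′)) (s≤s (s≤s z≤n)) (c , N , A , mem-bound , correct)
  with a′ , N≤n , few-sequences ← room c N =
  FoolingArgument.impossible a′ P (A n) (few-sequences _ (mem-bound n N≤n)) decides
  where
  n = Fooling.n a′
  P = ⌊log₂ n ⌋ ^ c
  decides : DecidesMinPeriodWithin (A n) n (Fooling.K a′) P
  decides s with b , p , runs , sound , complete , passes ← correct n s (Fooling.K a′) =
    b , p , runs , sound , complete , passes N≤n
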